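{- Let $G$ and $H$ be connected graphs of orders $m$ and $n$, respectively. For every integer $k \ge 1$, $$d_k(G \Box H) \le \min\{\, m\, d_k(H),\ n\, d_k(G) \,\}.$$
   Context: $G \Box H$ is the Cartesian product: vertex set $V(G)\times V(H)$, with $(x,y)$ adjacent to $(u,v)$ iff ($x=u$ and $yv \in E(H)$) or ($xu \in E(G)$ and $y=v$). The $k$-move deduction game ($k$ a positive integer) on a finite graph $G$: a layout places a finite number of searchers on vertices of $G$ (several searchers may share a vertex). Every searcher is initially mobile. A vertex is protected once it has been occupied by some searcher (so initially occupied vertices are protected); other vertices are unprotected. The game proceeds in stages. At each stage, for every vertex $v$ that has at least one unprotected neighbour: if the number of mobile searchers on $v$ is at least the number of unprotected neighbours of $v$, then the mobile searchers on $v$ move to the unprotected neighbours of $v$ so that each unprotected neighbour receives at least one searcher; excess mobile searchers on $v$ may also move to any of these unprotected neighbours. All moves in a stage happen simultaneously, newly occupied vertices become protected, and a searcher that has moved $k$ times becomes immobile. The process repeats until all vertices are protected or no searcher can move. A layout is successful if all vertices of $G$ end up protected. The $k$-move deduction number $d_k(G)$ is the minimum number of searchers in a successful layout on $G$. -}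

module Defs where

open import Data.Nat using (ℕ; zero; suc; _+_; _*_; _≤_; _<_; _<ᵇ_)
open import Data.Bool using (Bool; true; false; _∧_; _∨_; not; if_then_else_)
open import Data.Bool.Properties using (∧-comm; ∨-comm)
open import Data.Fin using (Fin; zero; suc; remQuot; _≟_)
open import Data.Product using (_×_; _,_; proj₁; proj₂; ∃; ∃-syntax)
open import Data.Sum using (_⊎_)
open import Relation.Nullary using (does)
open import Relation.Binary.PropositionalEquality using (_≡_; refl; cong₂; trans; sym)
open import Relation.Binary.Construct.Closure.ReflexiveTransitive using (Star)

record Graph : Set where
  field
    order      : ℕ
    adj        : Fin order → Fin order → Bool
    adj-sym    : ∀ x y → adj x y ≡ adj y x
    adj-irrefl : ∀ x → adj x x ≡ false
open Graph public

_==_ : ∀ {n} → Fin n → Fin n → Bool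
x == y = does (x ≟ y)

==-sym : ∀ {n} (x y : Fin n) → (x == y) ≡ (y == x)
==-sym x y with x ≟ y | y ≟ x
... | Relation.Nullary.yes _ | Relation.Nullary.yes _ = refl
... | Relation.Nullary.no _  | Relation.Nullary.no _  = refl
... | Relation.Nullary.yes p | Relation.Nullary.no ¬q = Data.Empty.⊥-elim (¬q (sym p))
  where import Data.Empty
... | Relation.Nullary.no ¬p | Relation.Nullary.yes q = Data.Empty.⊥-elim (¬p (sym q))
  where import Data.Empty

==-refl : ∀ {n} (x : Fin n) → (x == x) ≡ true
==-refl x with x ≟ x
... | Relation.Nullary.yes _ = refl
... | Relation.Nullary.no ¬p = Data.Empty.⊥-elim (¬p refl)
  where import Data.Empty

data Reach (G : Graph) : Fin (order G) → Fin (order G) → Set where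
  here : ∀ {x} → Reach G x x
  step : ∀ {x y z} → adj G x y ≡ true → Reach G y z → Reach G x z

Connected : Graph → Set
Connected G = ∀ x y → Reach G x y

□adj : (G H : Graph) → Fin (order G) × Fin (order H) → Fin (order G) × Fin (order H) → Bool
□adj G H (x , y) (u , v) = ((x == u) ∧ adj H y v) ∨ (adj G x u ∧ (y == v))

□adj-sym : (G H : Graph) → ∀ a b → □adj G H a b ≡ □adj G H b a
□adj-sym G H (x , y) (u , v)
  rewrite ==-sym x u | ==-sym y v | adj-sym G x u | adj-sym H y v = refl

□adj-irrefl : (G H : Graph) → ∀ a → □adj G H a a ≡ false
□adj-irrefl G H (x , y) rewrite ==-refl x | ==-refl y | adj-irrefl G x | adj-irrefl H y = refl

_□_ : Graph → Graph → Graph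
G □ H = record
  { order      = order G * order H
  ; adj        = λ a b → □adj G H (remQuot (order H) a) (remQuot (order H) b)
  ; adj-sym    = λ a b → □adj-sym G H (remQuot (order H) a) (remQuot (order H) b)
  ; adj-irrefl = λ a → □adj-irrefl G H (remQuot (order H) a)
  }

count : ∀ {n} → (Fin n → Bool) → ℕ
count {zero}  p = 0
count {suc n} p = (if p zero then 1 else 0) + count (λ i → p (suc i))

-- The k-move deduction game with s (individually tracked) searchers

record State (G : Graph) (s : ℕ) : Set where
  field
    pos   : Fin s → Fin (order G)
    moves : Fin s → ℕ
    prot  : Fin (order G) → Bool
open State public

occ : ∀ {G : Graph} {s} → (Fin s → Fin (order G)) → Fin (order G) → Bool
occ ps w = 0 <ᵇ count (λ i → ps i == w)

unprotNbrs : (G : Graph) {s : ℕ} → State G s → Fin (order G) → ℕ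
unprotNbrs G st v = count (λ w → adj G v w ∧ not (prot st w))

mobileAt : (G : Graph) (k : ℕ) {s : ℕ} → State G s → Fin (order G) → ℕ
mobileAt G k st v = count (λ i → (pos st i == v) ∧ (moves st i <ᵇ k))

Active : (G : Graph) (k : ℕ) {s : ℕ} → State G s → Fin (order G) → Set
Active G k st v = (1 ≤ unprotNbrs G st v) × (unprotNbrs G st v ≤ mobileAt G k st v)

-- One stage of the game (all moves simultaneous).
record Step (G : Graph) (k : ℕ) {s : ℕ} (st st' : State G s) : Set where
  field
    move-ok : ∀ i →
      (pos st' i ≡ pos st i × moves st' i ≡ moves st i)
      ⊎ (moves st i < k × Active G k st (pos st i)
         × adj G (pos st i) (pos st' i) ≡ true
         × prot st (pos st' i) ≡ false
         × moves st' i ≡ suc (moves st i))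
    cover : ∀ v w → Active G k st v → adj G v w ≡ true → prot st w ≡ false →
      ∃[ i ] (pos st i ≡ v × pos st' i ≡ w)
    prot-ok : ∀ w → prot st' w ≡ (prot st w ∨ occ {G} (pos st') w)

initState : (G : Graph) {s : ℕ} → (Fin s → Fin (order G)) → State G s
initState G ps = record { pos = ps ; moves = λ _ → 0 ; prot = occ {G} ps }

Successful : (G : Graph) (k : ℕ) {s : ℕ} → (Fin s → Fin (order G)) → Set
Successful G k {s} ps =
  ∃[ st ] (Star (Step G k) (initState G ps) st × (∀ w → prot st w ≡ true))

IsDeductionNumber : Graph → ℕ → ℕ → Set
IsDeductionNumber G k d =
  (∃[ ps ] Successful G k {d} ps)
  × (∀ s (ps : Fin s → Fin (order G)) → Successful G k ps → d ≤ s)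

-- Put an optimal layout of H on each of the m layers {x} × H of G □ H and let
-- every copy of a searcher imitate its original. A vertex can only fire while it
-- is occupied, hence protected, and the protection status of a vertex (x , y) of
-- G □ H stays that of y in H. So the neighbours (x′ , y) of a firing vertex (x , y)
-- outside its layer are protected, the unprotected neighbours of (x , y) are the
-- copies of those of y, and every play on H lifts to a play on G □ H with
-- m d_k(H) searchers; symmetrically with n d_k(G).
module Submission where

open import Defs
open import Data.Nat using (ℕ; zero; suc; _+_; _*_; _≤_; _⊓_; _<ᵇ_; s≤s; z≤n)
open import Data.Nat.Properties
  using (⊓-glb; ≤-trans; m≤n+m; +-assoc; +-identityʳ; +-0-commutativeMonoid; <⇒<ᵇ)
open import Algebra.Properties.CommutativeMonoid.Sum +-0-commutativeMonoid
  using (sum-syntax; sum-cong-≗; sum-replicate-zero; ∑-permute)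
open import Data.Bool using (Bool; true; false; _∧_; _∨_; not; if_then_else_)
open import Data.Bool.Properties
  using (∧-assoc; ∧-identityʳ; ∧-conicalˡ; ∧-conicalʳ; ∨-zeroʳ; T-≡)
open import Data.Fin using (Fin; zero; suc; combine; remQuot; _↑ˡ_; _↑ʳ_; _≟_)
open import Data.Fin.Permutation using (Permutation; permutation; _⟨$⟩ʳ_)
open import Data.Fin.Properties using (remQuot-combine; combine-remQuot)
open import Data.Product using (_×_; _,_; proj₁; proj₂; ∃-syntax; uncurry; swap)
open import Data.Sum using (_⊎_; inj₁; inj₂; [_,_]′; map₂)
open import Data.Empty using (⊥-elim)
open import Function using (id; _∘_; flip; Equivalence)
open import Relation.Nullary using (yes; no)
open import Relation.Nullary.Decidable using (dec-false)
open import Relation.Binary.PropositionalEquality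
open import Relation.Binary.Construct.Closure.ReflexiveTransitive using (Star; ε; _◅_)

count-cong : ∀ {n} {p q : Fin n → Bool} → (∀ i → p i ≡ q i) → count p ≡ count q
count-cong {zero}  p≗q = refl
count-cong {suc n} p≗q =
  cong₂ (λ b m → (if b then 1 else 0) + m) (p≗q zero) (count-cong (p≗q ∘ suc))

count≡∑ : ∀ {n} (p : Fin n → Bool) → count p ≡ ∑[ i < n ] (if p i then 1 else 0)
count≡∑ {zero}  p = refl
count≡∑ {suc n} p = cong ((if p zero then 1 else 0) +_) (count≡∑ (p ∘ suc))

count-false : ∀ n → count {n} (λ _ → false) ≡ 0
count-false zero    = refl
count-false (suc n) = count-false n

count-pos : ∀ {n} (p : Fin n → Bool) i → p i ≡ true → 1 ≤ count p
count-pos p zero    pi≡true rewrite pi≡true = s≤s z≤n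
count-pos p (suc i) pi≡true = ≤-trans (count-pos (p ∘ suc) i pi≡true) (m≤n+m _ _)

1≤count⇒∃ : ∀ {n} (p : Fin n → Bool) → 1 ≤ count p → ∃[ i ] p i ≡ true
1≤count⇒∃ {suc n} p 1≤count with p zero in p0≡b
... | true  = zero , p0≡b
... | false with 1≤count⇒∃ (p ∘ suc) 1≤count
...   | i , p[1+i]≡true = suc i , p[1+i]≡true

∑-↑ : ∀ m {n} (f : Fin (m + n) → ℕ) →
  ∑[ i < m + n ] f i ≡ ∑[ i < m ] f (i ↑ˡ n) + ∑[ j < n ] f (m ↑ʳ j)
∑-↑ zero    f = refl
∑-↑ (suc m) f = trans (cong (f zero +_) (∑-↑ m (f ∘ suc))) (sym (+-assoc (f zero) _ _))

∑-combine : ∀ m {n} (f : Fin (m * n) → ℕ) →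
  ∑[ i < m * n ] f i ≡ ∑[ c < m ] ∑[ j < n ] f (combine c j)
∑-combine zero    f = refl
∑-combine (suc m) {n} f =
  trans (∑-↑ n f) (cong (∑[ j < n ] f (j ↑ˡ (m * n)) +_) (∑-combine m (f ∘ (n ↑ʳ_))))

count-combine : ∀ m {n} (p : Fin (m * n) → Bool) →
  count p ≡ ∑[ c < m ] count (λ j → p (combine c j))
count-combine m {n} p = begin
  count p
    ≡⟨ count≡∑ p ⟩
  ∑[ i < m * n ] (if p i then 1 else 0)
    ≡⟨ ∑-combine m {n} _ ⟩
  ∑[ c < m ] ∑[ j < n ] (if p (combine c j) then 1 else 0)
    ≡⟨ sum-cong-≗ {m} (λ c → count≡∑ (p ∘ combine c)) ⟨
  ∑[ c < m ] count (λ j → p (combine c j))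
    ∎
  where open ≡-Reasoning

∑-count-==∧ : ∀ {m n} (c : Fin m) (p : Fin n → Bool) →
  ∑[ c′ < m ] count (λ j → (c′ == c) ∧ p j) ≡ count p
∑-count-==∧ {suc m} {n} zero p = begin
  count p + ∑[ c′ < m ] count {n} (λ _ → false)
    ≡⟨ cong (count p +_) (sum-cong-≗ {m} (λ _ → count-false n)) ⟩
  count p + ∑[ c′ < m ] 0
    ≡⟨ cong (count p +_) (sum-replicate-zero m) ⟩
  count p + 0
    ≡⟨ +-identityʳ _ ⟩
  count p
    ∎
  where open ≡-Reasoning
∑-count-==∧ {suc m} {n} (suc c) p =
  trans (cong (_+ ∑[ c′ < m ] count (λ j → (c′ == c) ∧ p j)) (count-false n)) (∑-count-==∧ c p)

==⇒≡ : ∀ {n} {x y : Fin n} → (x == y) ≡ true → x ≡ y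
==⇒≡ {x = x} {y} x==y with x ≟ y
... | yes x≡y = x≡y

true≢false : true ≢ false
true≢false ()

∨-true : ∀ a b → a ∨ b ≡ true → a ≡ true ⊎ b ≡ true
∨-true true  b _      = inj₁ refl
∨-true false b b≡true = inj₂ b≡true

-- P is the disjoint union of M copies (layers) of Q, plus edges that join two
-- copies of the same vertex of Q.
record Layering (Q P : Graph) (M : ℕ) : Set where
  field
    layer            : Fin M → Fin (order Q) → Fin (order P)
    index            : Fin (order P) → Fin M
    proj             : Fin (order P) → Fin (order Q)
    layer-index-proj : ∀ w → layer (index w) (proj w) ≡ w
    index-layer      : ∀ c y → index (layer c y) ≡ c
    proj-layer       : ∀ c y → proj (layer c y) ≡ y
    layer-adj        : ∀ c {y y′} → adj Q y y′ ≡ true → adj P (layer c y) (layer c y′) ≡ true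
    adj-layer        : ∀ {c c′ y y′} → adj P (layer c y) (layer c′ y′) ≡ true →
                       (c ≡ c′ × adj Q y y′ ≡ true) ⊎ y ≡ y′

module LayeringProperties {Q P : Graph} {M : ℕ} (L : Layering Q P M) where
  open Layering L public

  data AtLayer : Fin (order P) → Set where
    at : ∀ c y → AtLayer (layer c y)

  atLayer : ∀ w → AtLayer w
  atLayer w = subst AtLayer (layer-index-proj w) (at (index w) (proj w))

  layer-== : ∀ c′ y′ c y → (layer c′ y′ == layer c y) ≡ ((c′ == c) ∧ (y′ == y))
  layer-== c′ y′ c y with c′ ≟ c | y′ ≟ y
  ... | yes refl | yes refl = ==-refl (layer c y)
  ... | no c′≢c  | _        = dec-false (layer c′ y′ ≟ layer c y) λ eq →
    c′≢c (trans (sym (index-layer c′ y′)) (trans (cong index eq) (index-layer c y)))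
  ... | yes refl | no y′≢y  = dec-false (layer c y′ ≟ layer c y) λ eq →
    y′≢y (trans (sym (proj-layer c y′)) (trans (cong proj eq) (proj-layer c y)))

  layer-adj-≡ : ∀ c y y′ → adj P (layer c y) (layer c y′) ≡ adj Q y y′
  layer-adj-≡ c y y′ with adj Q y y′ in adjQ
  ... | true  = layer-adj c adjQ
  ... | false with adj P (layer c y) (layer c y′) in adjP
  ...   | false = refl
  ...   | true with adj-layer adjP
  ...     | inj₁ (_ , adjQ′) = trans (sym adjQ′) adjQ
  ...     | inj₂ refl        = trans (sym adjP) (adj-irrefl P (layer c y))

  layers : Permutation (M * order Q) (order P)
  layers = permutation (uncurry layer ∘ remQuot (order Q)) (λ w → combine (index w) (proj w))
    (λ w → trans (cong (uncurry layer) (remQuot-combine (index w) (proj w))) (layer-index-proj w))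
    (λ i → trans (cong₂ combine (index-layer _ _) (proj-layer _ _)) (combine-remQuot {M} (order Q) i))

  count-layers : (f : Fin (order P) → Bool) → count f ≡ ∑[ c < M ] count (λ y → f (layer c y))
  count-layers f = begin
    count f
      ≡⟨ count≡∑ f ⟩
    ∑[ w < order P ] (if f w then 1 else 0)
      ≡⟨ ∑-permute _ layers ⟩
    ∑[ i < M * order Q ] (if f (layers ⟨$⟩ʳ i) then 1 else 0)
      ≡⟨ count≡∑ (f ∘ (layers ⟨$⟩ʳ_)) ⟨
    count (λ i → f (layers ⟨$⟩ʳ i))
      ≡⟨ count-combine M _ ⟩
    ∑[ c < M ] count (λ y → f (layers ⟨$⟩ʳ combine c y))
      ≡⟨ sum-cong-≗ {M} (λ c → count-cong λ y → cong (f ∘ uncurry layer) (remQuot-combine c y)) ⟩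
    ∑[ c < M ] count (λ y → f (layer c y))
      ∎
    where open ≡-Reasoning

SearchersProtected : ∀ {G s} → State G s → Set
SearchersProtected st = ∀ j → prot st (pos st j) ≡ true

occ-self : ∀ {G s} (ps : Fin s → Fin (order G)) j → occ {G} ps (ps j) ≡ true
occ-self ps j = Equivalence.to T-≡ (<⇒<ᵇ (count-pos (λ i → ps i == ps j) j (==-refl (ps j))))

initState-searchersProtected : ∀ {G s} (ps : Fin s → Fin (order G)) →
  SearchersProtected (initState G ps)
initState-searchersProtected {G} = occ-self {G}

step-searchersProtected : ∀ {G k s} {st st′ : State G s} → Step G k st st′ →
  SearchersProtected st′
step-searchersProtected {G} {st = st} {st′} S j = begin
  prot st′ (pos st′ j)
    ≡⟨ Step.prot-ok S (pos st′ j) ⟩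
  prot st (pos st′ j) ∨ occ {G} (pos st′) (pos st′ j)
    ≡⟨ cong (prot st (pos st′ j) ∨_) (occ-self {G} (pos st′) j) ⟩
  prot st (pos st′ j) ∨ true
    ≡⟨ ∨-zeroʳ _ ⟩
  true
    ∎
  where open ≡-Reasoning

module Lifting {Q P : Graph} {M : ℕ} (L : Layering Q P M) (k : ℕ) where
  open LayeringProperties L

  copy : ∀ {s} → Fin (M * s) → Fin M
  copy {s} i = proj₁ (remQuot {M} s i)

  origin : ∀ {s} → Fin (M * s) → Fin s
  origin {s} i = proj₂ (remQuot {M} s i)

  origin-combine : ∀ {s} (c : Fin M) (j : Fin s) → origin (combine c j) ≡ j
  origin-combine c j = cong proj₂ (remQuot-combine c j)

  liftLayout : ∀ {s} → (Fin s → Fin (order Q)) → Fin (M * s) → Fin (order P)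
  liftLayout ps i = layer (copy i) (ps (origin i))

  liftLayout-combine : ∀ {s} (ps : Fin s → Fin (order Q)) c j →
    liftLayout ps (combine c j) ≡ layer c (ps j)
  liftLayout-combine ps c j = cong (λ (c′ , j′) → layer c′ (ps j′)) (remQuot-combine c j)

  -- The protection map is left free, constrained only pointwise by LiftsProtection,
  -- because the initial state of the lifted layout protects occ (liftLayout ps),
  -- which agrees with the pulled-back protection only up to ≗.
  liftState : ∀ {s} → State Q s → (Fin (order P) → Bool) → State P (M * s)
  liftState st p = record { pos = liftLayout (pos st) ; moves = moves st ∘ origin ; prot = p }

  LiftsProtection : ∀ {s} → (Fin (order P) → Bool) → State Q s → Set
  LiftsProtection p st = ∀ w → p w ≡ prot st (proj w)

  lifts-layer : ∀ {s} (st : State Q s) {p} → LiftsProtection p st →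
    ∀ c y → p (layer c y) ≡ prot st y
  lifts-layer st lifts c y = trans (lifts (layer c y)) (cong (prot st) (proj-layer c y))

  count-copies : ∀ {s} (ps : Fin s → Fin (order Q)) (g : Fin s → Bool) c y →
    count (λ i → (liftLayout ps i == layer c y) ∧ g (origin i)) ≡ count (λ j → (ps j == y) ∧ g j)
  count-copies ps g c y = begin
    count (λ i → (liftLayout ps i == layer c y) ∧ g (origin i))
      ≡⟨ count-combine M (λ i → (liftLayout ps i == layer c y) ∧ g (origin i)) ⟩
    ∑[ c′ < M ] count (λ j → (liftLayout ps (combine c′ j) == layer c y) ∧ g (origin (combine c′ j)))
      ≡⟨ sum-cong-≗ {M} (λ c′ → count-cong (in-copy c′)) ⟩
    ∑[ c′ < M ] count (λ j → (c′ == c) ∧ ((ps j == y) ∧ g j))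
      ≡⟨ ∑-count-==∧ c (λ j → (ps j == y) ∧ g j) ⟩
    count (λ j → (ps j == y) ∧ g j)
      ∎
    where
    open ≡-Reasoning
    in-copy : ∀ c′ j → ((liftLayout ps (combine c′ j) == layer c y) ∧ g (origin (combine c′ j)))
                       ≡ ((c′ == c) ∧ ((ps j == y) ∧ g j))
    in-copy c′ j = begin
      (liftLayout ps (combine c′ j) == layer c y) ∧ g (origin (combine c′ j))
        ≡⟨ cong₂ (λ v j′ → (v == layer c y) ∧ g j′) (liftLayout-combine ps c′ j) (origin-combine c′ j) ⟩
      (layer c′ (ps j) == layer c y) ∧ g j
        ≡⟨ cong (_∧ g j) (layer-== c′ (ps j) c y) ⟩
      ((c′ == c) ∧ (ps j == y)) ∧ g j
        ≡⟨ ∧-assoc (c′ == c) (ps j == y) (g j) ⟩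
      (c′ == c) ∧ ((ps j == y) ∧ g j)
        ∎

  mobileAt-lift : ∀ {s} (st : State Q s) p c y →
    mobileAt P k (liftState st p) (layer c y) ≡ mobileAt Q k st y
  mobileAt-lift st p c y = count-copies (pos st) (λ j → moves st j <ᵇ k) c y

  occ-lift : ∀ {s} (ps : Fin s → Fin (order Q)) w → occ {P} (liftLayout ps) w ≡ occ {Q} ps (proj w)
  occ-lift ps w with atLayer w
  ... | at c y rewrite proj-layer c y = cong (0 <ᵇ_) (begin
    count (λ i → liftLayout ps i == layer c y)
      ≡⟨ count-cong (λ i → ∧-identityʳ (liftLayout ps i == layer c y)) ⟨
    count (λ i → (liftLayout ps i == layer c y) ∧ true)
      ≡⟨ count-copies ps (λ _ → true) c y ⟩
    count (λ j → (ps j == y) ∧ true)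
      ≡⟨ count-cong (λ j → ∧-identityʳ (ps j == y)) ⟩
    count (λ j → ps j == y)
      ∎)
    where open ≡-Reasoning

  -- Neighbours of layer c y in other layers are copies of y, hence protected.
  unprotected-neighbour : ∀ {s} (st : State Q s) {y} → prot st y ≡ true → ∀ c c′ y′ →
    (adj P (layer c y) (layer c′ y′) ∧ not (prot st y′))
    ≡ ((c′ == c) ∧ (adj Q y y′ ∧ not (prot st y′)))
  unprotected-neighbour st {y} y-prot c c′ y′ with c′ ≟ c
  ... | yes refl = cong (_∧ not (prot st y′)) (layer-adj-≡ c y y′)
  ... | no c′≢c with adj P (layer c y) (layer c′ y′) in adjP
  ...   | false = refl
  ...   | true with adj-layer adjP
  ...     | inj₁ (c≡c′ , _) = ⊥-elim (c′≢c (sym c≡c′))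
  ...     | inj₂ refl rewrite y-prot = refl

  unprotNbrs-lift : ∀ {s} (st : State Q s) {p} → LiftsProtection p st →
    ∀ c {y} → prot st y ≡ true → unprotNbrs P (liftState st p) (layer c y) ≡ unprotNbrs Q st y
  unprotNbrs-lift st {p} lifts c {y} y-prot = begin
    count (λ w → adj P (layer c y) w ∧ not (p w))
      ≡⟨ count-layers _ ⟩
    ∑[ c′ < M ] count (λ y′ → adj P (layer c y) (layer c′ y′) ∧ not (p (layer c′ y′)))
      ≡⟨ sum-cong-≗ {M} (λ c′ → count-cong λ y′ → trans
           (cong (λ b → adj P (layer c y) (layer c′ y′) ∧ not b) (lifts-layer st lifts c′ y′))
           (unprotected-neighbour st y-prot c c′ y′)) ⟩
    ∑[ c′ < M ] count (λ y′ → (c′ == c) ∧ (adj Q y y′ ∧ not (prot st y′)))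
      ≡⟨ ∑-count-==∧ c (λ y′ → adj Q y y′ ∧ not (prot st y′)) ⟩
    count (λ y′ → adj Q y y′ ∧ not (prot st y′))
      ∎
    where open ≡-Reasoning

  Active-lift : ∀ {s} (st : State Q s) {p} → LiftsProtection p st →
    ∀ c {y} → prot st y ≡ true → Active P k (liftState st p) (layer c y) ≡ Active Q k st y
  Active-lift st {p} lifts c {y} y-prot =
    cong₂ (λ u m → 1 ≤ u × u ≤ m) (unprotNbrs-lift st lifts c y-prot) (mobileAt-lift st p c y)

  Active-lift⇒protected : ∀ {s} (st : State Q s) {p} → SearchersProtected st → ∀ c y →
    Active P k (liftState st p) (layer c y) → prot st y ≡ true
  Active-lift⇒protected st {p} searchers-prot c y (1≤unprot , unprot≤mobile)
    with 1≤count⇒∃ _ (≤-trans 1≤unprot (subst (unprotNbrs P (liftState st p) (layer c y) ≤_)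
                                             (mobileAt-lift st p c y) unprot≤mobile))
  ... | j , j-mobile-at-y =
    subst (λ v → prot st v ≡ true) (==⇒≡ (∧-conicalˡ _ _ j-mobile-at-y)) (searchers-prot j)

  liftStep : ∀ {s} {st st′ : State Q s} {p} → SearchersProtected st → LiftsProtection p st →
    Step Q k st st′ → Step P k (liftState st p) (liftState st′ (prot st′ ∘ proj))
  Step.move-ok (liftStep {st = st} {st′} searchers-prot lifts S) i with Step.move-ok S (origin i)
  ... | inj₁ (pos≡ , moves≡) = inj₁ (cong (layer (copy i)) pos≡ , moves≡)
  ... | inj₂ (moves<k , active , adjQ , unprotected , moves≡) =
    inj₂ ( moves<k
         , subst id (sym (Active-lift st lifts (copy i) (searchers-prot (origin i)))) active
         , layer-adj (copy i) adjQ
         , trans (lifts-layer st lifts (copy i) (pos st′ (origin i))) unprotected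
         , moves≡ )
  Step.cover (liftStep {st = st} {st′} searchers-prot lifts S) v w active adjP unprotected
    with atLayer v | atLayer w
  ... | at c y | at c′ y′ with Active-lift⇒protected st searchers-prot c y active | adj-layer adjP
  ...   | y-prot | inj₂ refl =
    ⊥-elim (true≢false (trans (sym y-prot) (trans (sym (lifts-layer st lifts c′ y)) unprotected)))
  ...   | y-prot | inj₁ (refl , adjQ)
    with Step.cover S y y′ (subst id (Active-lift st lifts c y-prot) active) adjQ
                           (trans (sym (lifts-layer st lifts c y′)) unprotected)
  ...     | j , pos≡ , pos′≡ =
    combine c j ,
    trans (liftLayout-combine (pos st) c j) (cong (layer c) pos≡) ,
    trans (liftLayout-combine (pos st′) c j) (cong (layer c) pos′≡)
  Step.prot-ok (liftStep {st′ = st′} _ lifts S) w =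
    trans (Step.prot-ok S (proj w)) (cong₂ _∨_ (sym (lifts w)) (sym (occ-lift (pos st′) w)))

  liftPlay : ∀ {s} {a b : State Q s} {p} → Star (Step Q k) a b →
    SearchersProtected a → LiftsProtection p a →
    ∃[ q ] (Star (Step P k) (liftState a p) (liftState b q) × LiftsProtection q b)
  liftPlay {p = p} ε _ lifts = p , ε , lifts
  liftPlay (S ◅ play) searchers-prot lifts
    with liftPlay play (step-searchersProtected S) (λ _ → refl)
  ... | q , play′ , lifts′ = q , liftStep searchers-prot lifts S ◅ play′ , lifts′

  liftSuccessful : ∀ {s} (ps : Fin s → Fin (order Q)) →
    Successful Q k ps → Successful P k (liftLayout ps)
  liftSuccessful ps (st , play , all-prot)
    with liftPlay play (initState-searchersProtected {Q} ps) (occ-lift ps)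
  ... | q , play′ , lifts = liftState st q , play′ , λ w → trans (lifts w) (all-prot (proj w))

deductionNumber-layering-≤ : ∀ {Q P M k dQ dP} → Layering Q P M →
  IsDeductionNumber Q k dQ → IsDeductionNumber P k dP → dP ≤ M * dQ
deductionNumber-layering-≤ {k = k} L ((ps , successful) , _) (_ , minimal) =
  minimal _ (liftLayout ps) (liftSuccessful ps successful)
  where open Lifting L k

adj-□-combine : ∀ G H x y u v → adj (G □ H) (combine x y) (combine u v)
                              ≡ (((x == u) ∧ adj H y v) ∨ (adj G x u ∧ (y == v)))
adj-□-combine G H x y u v = cong₂ (□adj G H) (remQuot-combine x y) (remQuot-combine u v)

□-adjʳ : ∀ G H x {y v} → adj H y v ≡ true → adj (G □ H) (combine x y) (combine x v) ≡ true
□-adjʳ G H x {y} {v} adjH rewrite adj-□-combine G H x y x v | ==-refl x | adjH = refl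

□-adjˡ : ∀ G H y {x u} → adj G x u ≡ true → adj (G □ H) (combine x y) (combine u y) ≡ true
□-adjˡ G H y {x} {u} adjG rewrite adj-□-combine G H x y u y | adjG | ==-refl y = ∨-zeroʳ _

adj-□ : ∀ G H {x y u v} → adj (G □ H) (combine x y) (combine u v) ≡ true →
  (x ≡ u × adj H y v ≡ true) ⊎ (adj G x u ≡ true × y ≡ v)
adj-□ G H {x} {y} {u} {v} adj□ with ∨-true _ _ (trans (sym (adj-□-combine G H x y u v)) adj□)
... | inj₁ x≡u∧adjH = inj₁ (==⇒≡ (∧-conicalˡ _ _ x≡u∧adjH) , ∧-conicalʳ _ _ x≡u∧adjH)
... | inj₂ adjG∧y≡v = inj₂ (∧-conicalˡ _ _ adjG∧y≡v , ==⇒≡ (∧-conicalʳ _ _ adjG∧y≡v))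

□-layeringʳ : ∀ G H → Layering H (G □ H) (order G)
□-layeringʳ G H = record
  { layer            = combine
  ; index            = proj₁ ∘ remQuot {order G} (order H)
  ; proj             = proj₂ ∘ remQuot {order G} (order H)
  ; layer-index-proj = combine-remQuot {order G} (order H)
  ; index-layer      = λ x y → cong proj₁ (remQuot-combine x y)
  ; proj-layer       = λ x y → cong proj₂ (remQuot-combine x y)
  ; layer-adj        = □-adjʳ G H
  ; adj-layer        = map₂ proj₂ ∘ adj-□ G H
  }

□-layeringˡ : ∀ G H → Layering G (G □ H) (order H)
□-layeringˡ G H = record
  { layer            = flip combine
  ; index            = proj₂ ∘ remQuot {order G} (order H)
  ; proj             = proj₁ ∘ remQuot {order G} (order H)
  ; layer-index-proj = combine-remQuot {order G} (order H)
  ; index-layer      = λ y x → cong proj₂ (remQuot-combine x y)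
  ; proj-layer       = λ y x → cong proj₁ (remQuot-combine x y)
  ; layer-adj        = □-adjˡ G H
  ; adj-layer        = [ inj₂ ∘ proj₁ , inj₁ ∘ swap ]′ ∘ adj-□ G H
  }

theorem4p2 : (G H : Graph) → Connected G → Connected H →
    (k : ℕ) → 1 ≤ k →
    (dG dH d : ℕ) →
    IsDeductionNumber G k dG → IsDeductionNumber H k dH →
    IsDeductionNumber (G □ H) k d →
    d ≤ (order G * dH) ⊓ (order H * dG)
theorem4p2 G H _ _ k _ dG dH d dG-number dH-number d-number =
  ⊓-glb (deductionNumber-layering-≤ (□-layeringʳ G H) dH-number d-number)
        (deductionNumber-layering-≤ (□-layeringˡ G H) dG-number d-number)
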